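{- Let $m,n\ge 1$. If there exists a binary $(mn,R)$-covering sequence of length $k$ where $n$ divides $k$, then there exists an $(m\times n,R)$-covering 2D-sequence of size $M\times N$ with $M=k/n$ and $N=2n-1$. If there exists a binary $(mn,R)$-covering sequence of length $k$ where $n$ does not divide $k$, then there exists an $(m\times n,R)$-covering 2D-sequence of size $M\times N$ with $N=2n-1$ and $\frac{k}{n}\le M\le\left\lceil\frac{k}{n}\right\rceil+m$.
   Context: A cyclic binary sequence of length $k$ has as its windows of length $L$ the words $(s_i,\ldots,s_{i+L-1})$, $0\le i\le k-1$, indices modulo $k$; it is an $(L,R)$-covering sequence if every $x\in\{0,1\}^L$ is within Hamming distance $R$ of some window. An $M\times N$ binary array $A=(A_{r,c})$ is regarded as doubly periodic (a torus); its $m\times n$ windows are the arrays $(A_{(r+a)\bmod M,\,(c+b)\bmod N})_{0\le a<m,\,0\le b<n}$ for $0\le r<M$, $0\le c<N$. It is an $(m\times n,R)$-covering 2D-sequence if for every binary $m\times n$ matrix $B$ there is a window $X$ with $d(B,X)\le R$, where $d$ counts differing entries. -}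

module Defs where

open import Data.Nat using (ℕ; zero; suc; _+_; _*_; NonZero)
open import Data.Nat.DivMod using (_%_; m%n<n)
open import Data.Bool using (Bool; true; false; if_then_else_)
open import Data.Bool.Properties using () renaming (_≟_ to _≟ᵇ_)
open import Data.Fin as F using (Fin; toℕ; fromℕ<)
open import Data.Product using (∃; _×_; _,_)
open import Relation.Nullary using (does)
open import Relation.Binary.PropositionalEquality using (_≡_)

Word : ℕ → Set
Word L = Fin L → Bool

hamming : ∀ {L} → Word L → Word L → ℕ
hamming {zero}  x y = 0
hamming {suc L} x y =
  (if does (x F.zero ≟ᵇ y F.zero) then 0 else 1) + hamming (λ j → x (F.suc j)) (λ j → y (F.suc j))

_⊕[_]_ : ℕ → (k : ℕ) → {{NonZero k}} → ℕ → Fin k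
(a ⊕[ k ] b) = fromℕ< (m%n<n (a + b) k)

CyclicSeq : ℕ → Set
CyclicSeq k = Fin k → Bool

window : ∀ {k} {{_ : NonZero k}} (L : ℕ) → CyclicSeq k → Fin k → Word L
window {k} L s i j = s (toℕ i ⊕[ k ] toℕ j)

IsCoveringSeq : ∀ {k} {{_ : NonZero k}} → ℕ → ℕ → CyclicSeq k → Set
IsCoveringSeq {k} L R s = ∀ (x : Word L) → ∃ λ (i : Fin k) → hamming x (window L s i) Data.Nat.≤ R
  where import Data.Nat

Matrix : ℕ → ℕ → Set
Matrix m n = Fin m → Fin n → Bool

dist : ∀ {m n} → Matrix m n → Matrix m n → ℕ
dist {zero}  A B = 0
dist {suc m} A B = hamming (A F.zero) (B F.zero)
                 + dist (λ a → A (F.suc a)) (λ a → B (F.suc a))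

window2 : ∀ {M N} {{_ : NonZero M}} {{_ : NonZero N}} (m n : ℕ) →
          Matrix M N → Fin M → Fin N → Matrix m n
window2 {M} {N} m n A r c a b = A (toℕ r ⊕[ M ] toℕ a) (toℕ c ⊕[ N ] toℕ b)

IsCovering2D : ∀ {M N} {{_ : NonZero M}} {{_ : NonZero N}} →
               ℕ → ℕ → ℕ → Matrix M N → Set
IsCovering2D {M} {N} m n R A =
  ∀ (B : Matrix m n) → ∃ λ (r : Fin M) → ∃ λ (c : Fin N) →
    dist B (window2 m n A r c) Data.Nat.≤ R
  where import Data.Nat

{-# OPTIONS --safe #-}
-- Stack the length-(2n-1) stretches of s starting at positions 0, n, 2n, … as the rows of an
-- array.  A window of s of length mn starting at i = q n + c (c < n), cut into m rows of
-- length n, is then the m × n window of the array at (q, c): its a-th row is the stretch of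
-- s at (q + a) n + c, which sits in array row q + a at columns c, …, c + n - 1 ≤ 2n - 2.
-- The row index q + a is reduced mod M, which is harmless either when M n = k (the rows
-- are then k-periodic in the row index) or when M ≥ ⌊k/n⌋ + m (no reduction happens).
-- Thus every m × n matrix, flattened row by row, is R-close to a window of s and hence
-- to a window of the array.
module Submission where

open import Data.Bool using (if_then_else_)
open import Data.Bool.Properties using () renaming (_≟_ to _≟ᵇ_)
open import Data.Fin as F using (Fin; toℕ; fromℕ<; _↑ˡ_; _↑ʳ_; combine; remQuot)
open import Data.Fin.Properties using (toℕ-fromℕ<; toℕ-injective; toℕ<n; toℕ-combine; remQuot-combine)
open import Data.Nat using (ℕ; zero; suc; _+_; _*_; _∸_; _≤_; _<_; NonZero; s≤s⁻¹; >-nonZero; >-nonZero⁻¹)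
open import Data.Nat.Divisibility using (_∣_; ∣⇒≤)
open import Data.Nat.DivMod
open import Data.Nat.Properties
open import Data.Nat.Tactic.RingSolver using (solve-∀)
open import Data.Product using (∃; _×_; _,_; Σ; uncurry)
open import Function using (_∘_)
open import Relation.Binary.PropositionalEquality
open import Relation.Nullary using (¬_; does)
open import Defs

hamming-cong : ∀ {L} {x x′ y y′ : Word L} → (∀ j → x j ≡ x′ j) → (∀ j → y j ≡ y′ j) →
               hamming x y ≡ hamming x′ y′
hamming-cong {zero}  x≗x′ y≗y′ = refl
hamming-cong {suc L} x≗x′ y≗y′ rewrite x≗x′ F.zero | y≗y′ F.zero =
  cong (_ +_) (hamming-cong (x≗x′ ∘ F.suc) (y≗y′ ∘ F.suc))

hamming-+ : ∀ n {L} (x y : Word (n + L)) →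
            hamming x y ≡ hamming (x ∘ (_↑ˡ L)) (y ∘ (_↑ˡ L)) + hamming (x ∘ (n ↑ʳ_)) (y ∘ (n ↑ʳ_))
hamming-+ zero    x y = refl
hamming-+ (suc n) x y =
  trans (cong (d +_) (hamming-+ n (x ∘ F.suc) (y ∘ F.suc))) (sym (+-assoc d _ _))
  where d = if does (x F.zero ≟ᵇ y F.zero) then 0 else 1

dist-cong : ∀ {m n} {A A′ B B′ : Matrix m n} →
            (∀ a b → A a b ≡ A′ a b) → (∀ a b → B a b ≡ B′ a b) → dist A B ≡ dist A′ B′
dist-cong {zero}  A≗A′ B≗B′ = refl
dist-cong {suc m} A≗A′ B≗B′ =
  cong₂ _+_ (hamming-cong (A≗A′ F.zero) (B≗B′ F.zero)) (dist-cong (A≗A′ ∘ F.suc) (B≗B′ ∘ F.suc))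

hamming≡dist-combine : ∀ {m n} (x y : Word (m * n)) →
                       hamming x y ≡ dist {m} {n} (λ a b → x (combine a b)) (λ a b → y (combine a b))
hamming≡dist-combine {zero} {n} x y = refl
hamming≡dist-combine {suc m} {n} x y =
  trans (hamming-+ n x y)
        (cong (hamming (x ∘ (_↑ˡ m * n)) (y ∘ (_↑ˡ m * n)) +_)
              (hamming≡dist-combine {m} {n} (x ∘ (n ↑ʳ_)) (y ∘ (n ↑ʳ_))))

covering2D-from-windows : ∀ {k M N} {{_ : NonZero k}} {{_ : NonZero M}} {{_ : NonZero N}}
  {m n R} (s : CyclicSeq k) (A : Matrix M N) → IsCoveringSeq (m * n) R s →
  (∀ i → ∃ λ r → ∃ λ c → ∀ a b → window2 m n A r c a b ≡ window (m * n) s i (combine a b)) →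
  IsCovering2D m n R A
covering2D-from-windows {m = m} {n} {R} s A s-covers windows B
  with i , close ← s-covers (uncurry B ∘ remQuot n)
  with r , c , window-eq ← windows i
  = r , c , subst (_≤ R) dist-eq close
  where
  dist-eq : hamming (uncurry B ∘ remQuot n) (window (m * n) s i) ≡ dist B (window2 m n A r c)
  dist-eq = trans (hamming≡dist-combine {m} {n} _ _)
                  (dist-cong (λ a b → cong (uncurry B) (remQuot-combine a b)) (λ a b → sym (window-eq a b)))

toℕ-⊕ : ∀ a k {{_ : NonZero k}} b → toℕ (a ⊕[ k ] b) ≡ (a + b) % k
toℕ-⊕ a k b = toℕ-fromℕ< (m%n<n (a + b) k)

shiftedRows : ∀ {k} {{_ : NonZero k}} (n M N : ℕ) → CyclicSeq k → Matrix M N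
shiftedRows {k} n M N s r c = s ((toℕ r * n) ⊕[ k ] toℕ c)

-- Row x mod M of shiftedRows holds what row x of the unbounded array (x, y) ↦ s (x n + y) would.
RowAgrees : (k n M : ℕ) .{{_ : NonZero k}} .{{_ : NonZero M}} → ℕ → Set
RowAgrees k n M x = ∀ y → (x % M * n + y) % k ≡ (x * n + y) % k

rowAgrees-periodic : ∀ {k n M} .{{_ : NonZero k}} .{{_ : NonZero M}} → M * n ≡ k →
                     ∀ x → RowAgrees k n M x
rowAgrees-periodic {k} {n} {M} Mn≡k x y = begin
  (x % M * n + y) % k                        ≡⟨ [m+kn]%n≡m%n (x % M * n + y) (x / M) k ⟨
  (x % M * n + y + x / M * k) % k            ≡⟨ cong (λ t → (x % M * n + y + x / M * t) % k) Mn≡k ⟨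
  (x % M * n + y + x / M * (M * n)) % k      ≡⟨ cong (_% k) (regroup (x % M) (x / M) M n y) ⟩
  ((x % M + x / M * M) * n + y) % k          ≡⟨ cong (λ t → (t * n + y) % k) (m≡m%n+[m/n]*n x M) ⟨
  (x * n + y) % k                            ∎
  where
  open ≡-Reasoning
  regroup : ∀ r q M n y → r * n + y + q * (M * n) ≡ (r + q * M) * n + y
  regroup = solve-∀

rowAgrees-< : ∀ {k n M x} .{{_ : NonZero k}} .{{_ : NonZero M}} → x < M → RowAgrees k n M x
rowAgrees-< {k} {n} x<M y = cong (λ t → (t * n + y) % k) (m<n⇒m%n≡m x<M)

m<n⇒o<n⇒m+o<2*n∸1 : ∀ {m n o} → m < n → o < n → m + o < 2 * n ∸ 1
m<n⇒o<n⇒m+o<2*n∸1 {m} {suc n} {o} m<n o<n =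
  subst (m + o <_) (sym (cong (n +_) (+-identityʳ (suc n)))) (+-mono-≤-< (s≤s⁻¹ m<n) o<n)

2*n∸1-nonZero : ∀ n .{{_ : NonZero n}} → NonZero (2 * n ∸ 1)
2*n∸1-nonZero n = >-nonZero (m<n⇒o<n⇒m+o<2*n∸1 (>-nonZero⁻¹ n) (>-nonZero⁻¹ n))

shiftedRows-isCovering : ∀ {k M N} {{_ : NonZero k}} {{_ : NonZero M}} {{_ : NonZero N}}
  m n .{{_ : NonZero n}} R (s : CyclicSeq k) → IsCoveringSeq (m * n) R s → 2 * n ∸ 1 ≤ N →
  (∀ i → i < k → i / n < M) → (∀ i a → i < k → a < m → RowAgrees k n M (i / n + a)) →
  IsCovering2D m n R (shiftedRows n M N s)
shiftedRows-isCovering {k} {M} {N} m n R s s-covers N-wide rows-fit rows-agree =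
  covering2D-from-windows s (shiftedRows n M N s) s-covers window-at
  where
  columns-fit : ∀ {c b} → c < n → b < n → c + b < N
  columns-fit c<n b<n = <-≤-trans (m<n⇒o<n⇒m+o<2*n∸1 c<n b<n) N-wide

  window-at : ∀ i → ∃ λ r → ∃ λ c → ∀ a b →
              window2 m n (shiftedRows n M N s) r c a b ≡ window (m * n) s i (combine a b)
  window-at i = r , c , λ a b → cong s (toℕ-injective (index-eq a b))
    where
    q = toℕ i / n
    c′ = toℕ i % n
    r : Fin M
    r = fromℕ< (rows-fit (toℕ i) (toℕ<n i))
    c : Fin N
    c = fromℕ< (subst (_< N) (+-identityʳ c′) (columns-fit (m%n<n (toℕ i) n) (>-nonZero⁻¹ n)))
    regroup : ∀ q a n c b → (q + a) * n + (c + b) ≡ (c + q * n) + (n * a + b)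
    regroup = solve-∀
    index-eq : ∀ a b → toℕ ((toℕ (toℕ r ⊕[ M ] toℕ a) * n) ⊕[ k ] toℕ (toℕ c ⊕[ N ] toℕ b))
                     ≡ toℕ (toℕ i ⊕[ k ] toℕ (combine a b))
    index-eq a b = begin
      toℕ ((toℕ (toℕ r ⊕[ M ] toℕ a) * n) ⊕[ k ] toℕ (toℕ c ⊕[ N ] toℕ b))
        ≡⟨ toℕ-⊕ (toℕ (toℕ r ⊕[ M ] toℕ a) * n) k (toℕ (toℕ c ⊕[ N ] toℕ b)) ⟩
      (toℕ (toℕ r ⊕[ M ] toℕ a) * n + toℕ (toℕ c ⊕[ N ] toℕ b)) % k
        ≡⟨ cong₂ (λ u v → (u * n + v) % k) (toℕ-⊕ (toℕ r) M (toℕ a)) (toℕ-⊕ (toℕ c) N (toℕ b)) ⟩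
      ((toℕ r + toℕ a) % M * n + (toℕ c + toℕ b) % N) % k
        ≡⟨ cong₂ (λ u v → ((u + toℕ a) % M * n + (v + toℕ b) % N) % k) (toℕ-fromℕ< _) (toℕ-fromℕ< _) ⟩
      ((q + toℕ a) % M * n + (c′ + toℕ b) % N) % k
        ≡⟨ cong (λ v → ((q + toℕ a) % M * n + v) % k)
                (m<n⇒m%n≡m (columns-fit (m%n<n (toℕ i) n) (toℕ<n b))) ⟩
      ((q + toℕ a) % M * n + (c′ + toℕ b)) % k
        ≡⟨ rows-agree (toℕ i) (toℕ a) (toℕ<n i) (toℕ<n a) (c′ + toℕ b) ⟩
      ((q + toℕ a) * n + (c′ + toℕ b)) % k
        ≡⟨ cong (_% k) (regroup q (toℕ a) n c′ (toℕ b)) ⟩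
      (c′ + q * n + (n * toℕ a + toℕ b)) % k
        ≡⟨ cong₂ (λ u v → (u + v) % k) (m≡m%n+[m/n]*n (toℕ i) n) (toℕ-combine a b) ⟨
      (toℕ i + toℕ (combine a b)) % k
        ≡⟨ toℕ-⊕ (toℕ i) k _ ⟨
      toℕ (toℕ i ⊕[ k ] toℕ (combine a b)) ∎
      where open ≡-Reasoning

HasCovering2D : (m n R M N : ℕ) → Set
HasCovering2D m n R M N =
  ∃ λ (A : Matrix M N) → Σ (NonZero M) λ nzM → Σ (NonZero N) λ nzN → IsCovering2D {{nzM}} {{nzN}} m n R A

covering2D-divisible : ∀ m n R {k} .{{_ : NonZero n}} {{_ : NonZero k}} (s : CyclicSeq k) →
  IsCoveringSeq (m * n) R s → n ∣ k → HasCovering2D m n R (k / n) (2 * n ∸ 1)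
covering2D-divisible m n R {k} s s-covers n∣k =
  shiftedRows n (k / n) (2 * n ∸ 1) s , M-nonZero , N-nonZero ,
  shiftedRows-isCovering m n R s s-covers ≤-refl rows-fit
    (λ i a _ _ → rowAgrees-periodic {M = k / n} (m/n*n≡m n∣k) (i / n + a))
  where
  instance
    M-nonZero : NonZero (k / n)
    M-nonZero = >-nonZero (m≥n⇒m/n>0 (∣⇒≤ n∣k))
    N-nonZero : NonZero (2 * n ∸ 1)
    N-nonZero = 2*n∸1-nonZero n
  rows-fit : ∀ i → i < k → i / n < k / n
  rows-fit i i<k = m<n*o⇒m/o<n (subst (i <_) (sym (m/n*n≡m n∣k)) i<k)

covering2D-unwrapped : ∀ m n R {k} .{{_ : NonZero m}} .{{_ : NonZero n}} {{_ : NonZero k}} (s : CyclicSeq k) →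
  IsCoveringSeq (m * n) R s → HasCovering2D m n R (k / n + m) (2 * n ∸ 1)
covering2D-unwrapped m n R {k} s s-covers =
  shiftedRows n (k / n + m) (2 * n ∸ 1) s , M-nonZero , N-nonZero ,
  shiftedRows-isCovering m n R s s-covers ≤-refl
    (λ i i<k → ≤-<-trans (m≤m+n (i / n) 0) (rows-stay i 0 i<k (>-nonZero⁻¹ m)))
    (λ i a i<k a<m → rowAgrees-< (rows-stay i a i<k a<m))
  where
  instance
    M-nonZero : NonZero (k / n + m)
    M-nonZero = >-nonZero (<-≤-trans (>-nonZero⁻¹ m) (m≤n+m m (k / n)))
    N-nonZero : NonZero (2 * n ∸ 1)
    N-nonZero = 2*n∸1-nonZero n
  rows-stay : ∀ i a → i < k → a < m → i / n + a < k / n + m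
  rows-stay i a i<k a<m = +-mono-≤-< (/-monoˡ-≤ n (<⇒≤ i<k)) a<m

m≤n*[m/n+o] : ∀ m n o .{{_ : NonZero n}} .{{_ : NonZero o}} → m ≤ n * (m / n + o)
m≤n*[m/n+o] m n o = begin
  m                   ≡⟨ m≡m%n+[m/n]*n m n ⟩
  m % n + m / n * n   ≤⟨ +-monoˡ-≤ (m / n * n) (≤-trans (m%n≤n m n) (m≤m*n n o)) ⟩
  n * o + m / n * n   ≡⟨ regroup n o (m / n) ⟩
  n * (m / n + o)     ∎
  where
  open ≤-Reasoning
  regroup : ∀ n o q → n * o + q * n ≡ n * (q + o)
  regroup = solve-∀

m/n≤[m+n∸1]/n : ∀ m n .{{_ : NonZero n}} → m / n ≤ (m + n ∸ 1) / n
m/n≤[m+n∸1]/n m n =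
  /-monoˡ-≤ n (subst (m ≤_) (sym (+-∸-assoc m (>-nonZero⁻¹ n))) (m≤m+n m (n ∸ 1)))

theorem7 : ∀ (m n R k : ℕ) → .{{_ : NonZero m}} → .{{_ : NonZero n}} → {{_ : NonZero k}} →
    Σ (CyclicSeq k) (IsCoveringSeq (m * n) R) →
    ((n ∣ k) →
      ∃ λ (A : Matrix (k / n) (2 * n ∸ 1)) →
        Σ (NonZero (k / n)) λ nzM → Σ (NonZero (2 * n ∸ 1)) λ nzN →
          IsCovering2D {{nzM}} {{nzN}} m n R A)
    × (¬ (n ∣ k) →
      ∃ λ (M : ℕ) → k ≤ n * M × M ≤ (k + n ∸ 1) / n + m ×
        ∃ λ (A : Matrix M (2 * n ∸ 1)) →
          Σ (NonZero M) λ nzM → Σ (NonZero (2 * n ∸ 1)) λ nzN →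
            IsCovering2D {{nzM}} {{nzN}} m n R A)
theorem7 m n R k (s , s-covers) =
  covering2D-divisible m n R s s-covers ,
  -- the construction with M = ⌊k/n⌋ + m works whether or not n divides k
  λ _ → k / n + m , m≤n*[m/n+o] k n m , +-monoˡ-≤ m (m/n≤[m+n∸1]/n k n) ,
        covering2D-unwrapped m n R s s-covers
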